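{- Let $(P,\leq,{}',M,R,0,1)$ be an operator left residuated poset. Then for all $x,y\in P$: $R(x,y)=P$ if and only if $x\leq y$.
   Context: For a poset $(P,\leq)$ and $A\subseteq P$ let $L(A)=\{x\in P\mid x\leq a\text{ for all }a\in A\}$ and $U(A)=\{x\in P\mid a\leq x\text{ for all }a\in A\}$; write $L(x)=L(\{x\})$, and, when several elements or subsets are listed as arguments, the union of them is meant (e.g. $L(x,y)=L(\{x,y\})$, $L(U(x,y),z)=L(U(\{x,y\})\cup\{z\})$). An operator left residuated poset is an ordered seventuple $(P,\leq,{}',M,R,0,1)$ where $(P,\leq,0,1)$ is a bounded poset with least element $0$ and greatest element $1$, ${}'$ is a unary operation on $P$, and $M,R$ are mappings from $P^2$ to $2^P$ such that for all $x,y,z\in P$: (i) $M(x,1)=M(1,x)=L(x)$; (ii) $M(x,y)\subseteq L(z)$ if and only if $L(x)\subseteq R(y,z)$; (iii) $R(x,0)=L(x')$. -}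

module Defs where

open import Level using (Level; _⊔_; suc)
open import Relation.Binary.Structures using (IsPartialOrder)
open import Relation.Binary.PropositionalEquality using (_≡_)
open import Relation.Unary using (Pred; _⊆_; _∈_)
open import Data.Product using (_×_)

_≐_ : ∀ {a ℓ} {A : Set a} → Pred A ℓ → Pred A ℓ → Set (a ⊔ ℓ)
S ≐ T = (S ⊆ T) × (T ⊆ S)

-- The subset-valued maps M, R take values in Pred Carrier ℓ₂ (ℓ₂ = level of ≤,
-- so that L(x) = { z | z ≤ x } lives at the same level).
record OLRPoset (c ℓ₂ : Level) : Set (suc (c ⊔ ℓ₂)) where
  infix 4 _≤_
  field
    Carrier : Set c
    _≤_ : Carrier → Carrier → Set ℓ₂
    isPartialOrder : IsPartialOrder _≡_ _≤_
  Lo : Carrier → Pred Carrier ℓ₂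
  Lo x z = z ≤ x
  field
    𝟘 𝟙 : Carrier
    𝟘-least : ∀ x → 𝟘 ≤ x
    𝟙-greatest : ∀ x → x ≤ 𝟙
    _′ : Carrier → Carrier
    M R : Carrier → Carrier → Pred Carrier ℓ₂
    M-𝟙ʳ : ∀ x → M x 𝟙 ≐ Lo x
    M-𝟙ˡ : ∀ x → M 𝟙 x ≐ Lo x
    adj→ : ∀ x y z → M x y ⊆ Lo z → Lo x ⊆ R y z
    adj← : ∀ x y z → Lo x ⊆ R y z → M x y ⊆ Lo z
    R-𝟘 : ∀ x → R x 𝟘 ≐ Lo (x ′)

-- Since M(1,x) = L(x), the residuation law with 1 in the first argument says
-- L(1) ⊆ R(x,y) iff L(x) ⊆ L(y); moreover L(1) = P, and L(x) ⊆ L(y) iff x ≤ y.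
module Submission where

open import Defs
open import Relation.Unary using (Pred; _∈_; _⊆_)
open import Function.Bundles using (_⇔_; mk⇔)
open import Function.Construct.Symmetry using (⇔-sym)
open import Function.Construct.Composition using (_⇔-∘_)
open import Data.Product using (proj₁; proj₂)
open import Relation.Binary.Structures using (IsPartialOrder)

module _ {c ℓ} (𝒫 : OLRPoset c ℓ) where
  open OLRPoset 𝒫
  open IsPartialOrder isPartialOrder using (refl; trans)

  Lo-⊆⇔≤ : ∀ x y → Lo x ⊆ Lo y ⇔ x ≤ y
  Lo-⊆⇔≤ x y = mk⇔ to from
    where
    to : Lo x ⊆ Lo y → x ≤ y
    to h = h refl
    from : x ≤ y → Lo x ⊆ Lo y
    from x≤y z≤x = trans z≤x x≤y

  Lo-𝟙-⊆⇔universal : (S : Pred Carrier ℓ) → Lo 𝟙 ⊆ S ⇔ (∀ z → z ∈ S)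
  Lo-𝟙-⊆⇔universal S = mk⇔ to from
    where
    to : Lo 𝟙 ⊆ S → ∀ z → z ∈ S
    to h z = h (𝟙-greatest z)
    from : (∀ z → z ∈ S) → Lo 𝟙 ⊆ S
    from h {z} _ = h z

  Lo-𝟙-⊆-R⇔Lo-⊆ : ∀ x y → Lo 𝟙 ⊆ R x y ⇔ Lo x ⊆ Lo y
  Lo-𝟙-⊆-R⇔Lo-⊆ x y = mk⇔ to from
    where
    to : Lo 𝟙 ⊆ R x y → Lo x ⊆ Lo y
    to h z≤x = adj← 𝟙 x y h (proj₂ (M-𝟙ˡ x) z≤x)
    from : Lo x ⊆ Lo y → Lo 𝟙 ⊆ R x y
    from h = adj→ 𝟙 x y (λ w∈M → h (proj₁ (M-𝟙ˡ x) w∈M))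

lemma1 : ∀ {c ℓ} (𝒫 : OLRPoset c ℓ) → let open OLRPoset 𝒫 in
    ∀ x y → ((∀ z → z ∈ R x y) ⇔ x ≤ y)
lemma1 𝒫 x y =
  Lo-⊆⇔≤ 𝒫 x y ⇔-∘ (Lo-𝟙-⊆-R⇔Lo-⊆ 𝒫 x y ⇔-∘ ⇔-sym (Lo-𝟙-⊆⇔universal 𝒫 (R x y)))
  where open OLRPoset 𝒫
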